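{- Let $\mathcal{CS}$ be any constant specification. For every formula $A$ of the language of $\mathsf{LP}^{\mathsf{C}}_h$: $\vdash_{\mathcal{CS}} A$ if and only if $\mathcal{M}\Vdash A$ for every M-model $\mathcal{M}$ meeting $\mathcal{CS}$, where an M-model is an AF-model whose set of worlds is a singleton.
   Context: Fix a number $h\ge 1$ of agents. Throughout, $i$ ranges over $\{1,\dots,h\}$, $*$ over $\{1,\dots,h,\mathsf{C}\}$, and $\circledast$ over $\{1,\dots,h,\mathsf{E},\mathsf{C}\}$. For each $\circledast$ let $\mathrm{Cons}_\circledast$ (proof constants) and $\mathrm{Var}_\circledast$ (proof variables) be countably infinite sets, all pairwise disjoint. Evidence terms $\mathrm{Tm}_1,\dots,\mathrm{Tm}_h,\mathrm{Tm}_{\mathsf{E}},\mathrm{Tm}_{\mathsf{C}}$ are defined by simultaneous induction: $\mathrm{Cons}_\circledast\cup\mathrm{Var}_\circledast\subseteq\mathrm{Tm}_\circledast$; if $t\in\mathrm{Tm}_i$ then $!_i t\in\mathrm{Tm}_i$; if $t,s\in\mathrm{Tm}_*$ then $t+_*s,\ t\cdot_* s\in\mathrm{Tm}_*$; if $t_1\in\mathrm{Tm}_1,\dots,t_h\in\mathrm{Tm}_h$ then $\langle t_1,\dots,t_h\rangle\in\mathrm{Tm}_{\mathsf{E}}$; if $t\in\mathrm{Tm}_{\mathsf{E}}$ then $\pi_i t\in\mathrm{Tm}_i$; if $t\in\mathrm{Tm}_{\mathsf{C}}$ then $\mathsf{hd}(t),\mathsf{tl}(t)\in\mathrm{Tm}_{\mathsf{E}}$;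 if $t\in\mathrm{Tm}_{\mathsf{C}}$ and $s\in\mathrm{Tm}_{\mathsf{E}}$ then $\mathsf{ind}(t,s)\in\mathrm{Tm}_{\mathsf{C}}$. $\mathrm{Tm}$ is the union of all these sets. Formulae are built from a countable set $\mathrm{Prop}$ of propositional variables using $\neg,\wedge,\vee,\to$ and the rule: if $A$ is a formula and $t\in\mathrm{Tm}_\circledast$ then $t{:}_\circledast A$ is a formula (indices on $!,+,\cdot$ omitted when clear). Axioms of $\mathsf{LP}^{\mathsf{C}}_h$ (all instances): (1) propositional tautologies; (2) $t{:}_*(A\to B)\to(s{:}_*A\to (t\cdot s){:}_*B)$; (3) $t{:}_*A\to(t+s){:}_*A$ and $s{:}_*A\to(t+s){:}_*A$; (4) $t{:}_iA\to A$; (5) $t{:}_iA\to (!t){:}_i\, t{:}_iA$; (6) $t_1{:}_1A\wedge\dots\wedge t_h{:}_hA\to\langle t_1,\dots,t_h\rangle{:}_{\mathsf{E}}A$; (7) $t{:}_{\mathsf{E}}A\to (\pi_it){:}_iA$; (8) $t{:}_{\mathsf{C}}A\to\mathsf{hd}(t){:}_{\mathsf{E}}A$ and $t{:}_{\mathsf{C}}A\to\mathsf{tl}(t){:}_{\mathsf{E}}\,t{:}_{\mathsf{C}}A$; (9) $A\wedge t{:}_{\mathsf{C}}(A\to s{:}_{\mathsf{E}}A)\to\mathsf{ind}(t,s){:}_{\mathsf{C}}A$. A constant specification $\mathcal{CS}$ is any set of formulae $c{:}_\circledast A$ with $c\in\mathrm{Cons}_\circledast$ and $A$ an axiom. $\mathsf{LP}^{\mathsf{C}}_h(\mathcal{CS})$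 is the Hilbert system with these axioms, modus ponens, and axiom necessitation (derive $c{:}_\circledast A$ whenever $c{:}_\circledast A\in\mathcal{CS}$); $\vdash_{\mathcal{CS}}A$ means $A$ is derivable in it. AF-models: an AF-model meeting $\mathcal{CS}$ is $\mathcal{M}=(W,R,\mathcal{E},\nu)$ with $W\neq\emptyset$, reflexive transitive relations $R_1,\dots,R_h$ on $W$, $\nu:\mathrm{Prop}\to\mathcal{P}(W)$, $R_{\mathsf{E}}:=R_1\cup\dots\cup R_h$, $R_{\mathsf{C}}:=\bigcup_{n\ge1}(R_{\mathsf{E}})^n$, and an evidence function $\mathcal{E}:W\times\mathrm{Tm}\to\mathcal{P}(\text{formulae})$, writing $\mathcal{E}_\circledast$ for its restriction to $W\times\mathrm{Tm}_\circledast$, such that for all $w,v\in W$: (monotonicity) $\mathcal{E}_*(w,t)\subseteq\mathcal{E}_*(v,t)$ whenever $(w,v)\in R_*$; (constant specification) $c{:}_\circledast A\in\mathcal{CS}$ implies $A\in\mathcal{E}_\circledast(w,c)$; (application) $A\to B\in\mathcal{E}_*(w,t)$ and $A\in\mathcal{E}_*(w,s)$ imply $B\in\mathcal{E}_*(w,t\cdot s)$; (sum) $\mathcal{E}_*(w,s)\cup\mathcal{E}_*(w,t)\subseteq\mathcal{E}_*(w,s+t)$; (inspection) $A\in\mathcal{E}_i(w,t)$ implies $t{:}_iA\in\mathcal{E}_i(w,!t)$; (tupling) $A\in\mathcal{E}_i(w,t_i)$ for all $i$ implies $A\in\mathcal{E}_{\mathsf{E}}(w,\langle t_1,\dots,t_h\rangle)$;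 (projection) $A\in\mathcal{E}_{\mathsf{E}}(w,t)$ implies $A\in\mathcal{E}_i(w,\pi_it)$; (co-closure) $A\in\mathcal{E}_{\mathsf{C}}(w,t)$ implies $A\in\mathcal{E}_{\mathsf{E}}(w,\mathsf{hd}(t))$ and $t{:}_{\mathsf{C}}A\in\mathcal{E}_{\mathsf{E}}(w,\mathsf{tl}(t))$; (induction) $A\in\mathcal{E}_{\mathsf{E}}(w,s)$ and $A\to s{:}_{\mathsf{E}}A\in\mathcal{E}_{\mathsf{C}}(w,t)$ imply $A\in\mathcal{E}_{\mathsf{C}}(w,\mathsf{ind}(t,s))$. Satisfaction: $\mathcal{M},w\Vdash P$ iff $w\in\nu(P)$; classical for connectives; $\mathcal{M},w\Vdash t{:}_\circledast A$ iff $A\in\mathcal{E}_\circledast(w,t)$ and $\mathcal{M},v\Vdash A$ for all $v$ with $(w,v)\in R_\circledast$. $\mathcal{M}\Vdash A$ means $\mathcal{M},w\Vdash A$ for all $w\in W$. -}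

module Defs where

open import Data.Nat using (ℕ; zero; suc)
open import Data.Fin using (Fin)
import Data.Fin as Fin
open import Data.Bool using (Bool; true; false; not; _∧_; _∨_)
open import Data.Product using (Σ; _×_; _,_)
open import Data.Sum using (_⊎_)
open import Data.Empty using (⊥)
open import Level using (Level) renaming (suc to lsuc; zero to lzero)
open import Relation.Binary.PropositionalEquality using (_≡_)
open import Relation.Binary.Construct.Closure.Transitive using (TransClosure)

data Sort (h : ℕ) : Set where
  ag : Fin h → Sort h
  E  : Sort h
  C  : Sort h

data Star {h : ℕ} : Sort h → Set where
  agS : (i : Fin h) → Star (ag i)
  CS  : Star C

-- Evidence terms Tm_⊛ (constants and variables of sort ⊛ are indexed
-- by ℕ; constants/variables of different sorts are distinct since the
-- sort is part of the term's type).

data Tm (h : ℕ) : Sort h → Set where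
  cns  : {s : Sort h} → ℕ → Tm h s
  var  : {s : Sort h} → ℕ → Tm h s
  !_   : {i : Fin h} → Tm h (ag i) → Tm h (ag i)
  plus : {s : Sort h} → Star s → Tm h s → Tm h s → Tm h s
  app  : {s : Sort h} → Star s → Tm h s → Tm h s → Tm h s
  tup  : ((i : Fin h) → Tm h (ag i)) → Tm h E
  proj : (i : Fin h) → Tm h E → Tm h (ag i)
  hd   : Tm h C → Tm h E
  tl   : Tm h C → Tm h E
  ind  : Tm h C → Tm h E → Tm h C

infixr 4 _⇒_
infixr 5 _∨'_
infixr 6 _∧'_

data Fm (h : ℕ) : Set where
  atom  : ℕ → Fm h
  ¬'_   : Fm h → Fm h
  _∧'_  : Fm h → Fm h → Fm h
  _∨'_  : Fm h → Fm h → Fm h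
  _⇒_   : Fm h → Fm h → Fm h
  just  : {s : Sort h} → Tm h s → Fm h → Fm h

-- Propositional tautologies: formulas true under every Boolean
-- valuation in which propositional variables and justification
-- formulas t:A are treated as atoms.

evalB : {h : ℕ} → (ℕ → Bool) → ({s : Sort h} → Tm h s → Fm h → Bool) → Fm h → Bool
evalB v j (atom p)   = v p
evalB v j (¬' A)     = not (evalB v j A)
evalB v j (A ∧' B)   = evalB v j A ∧ evalB v j B
evalB v j (A ∨' B)   = evalB v j A ∨ evalB v j B
evalB v j (A ⇒ B)    = not (evalB v j A) ∨ evalB v j B
evalB v j (just t A) = j t A

Tautology : {h : ℕ} → Fm h → Set
Tautology {h} A = (v : ℕ → Bool) (j : {s : Sort h} → Tm h s → Fm h → Bool) → evalB v j A ≡ true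

-- finite conjunction  f 0 ∧ (f 1 ∧ (… ∧ f (n-1)))  (right-nested);
-- the empty conjunction (n = 0, never used since h ≥ 1) is  p₀ → p₀
bigConj : {h : ℕ} (n : ℕ) → (Fin n → Fm h) → Fm h
bigConj zero    f = atom 0 ⇒ atom 0
bigConj (suc zero) f = f Fin.zero
bigConj (suc (suc n)) f = f Fin.zero ∧' bigConj (suc n) (λ i → f (Fin.suc i))

data Axiom {h : ℕ} : Fm h → Set where
  A1  : {A : Fm h} → Tautology A → Axiom A
  A2  : {s : Sort h} (p : Star s) {t u : Tm h s} {A B : Fm h} →
        Axiom (just t (A ⇒ B) ⇒ (just u A ⇒ just (app p t u) B))
  A3l : {s : Sort h} (p : Star s) {t u : Tm h s} {A : Fm h} →
        Axiom (just t A ⇒ just (plus p t u) A)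
  A3r : {s : Sort h} (p : Star s) {t u : Tm h s} {A : Fm h} →
        Axiom (just u A ⇒ just (plus p t u) A)
  A4  : {i : Fin h} {t : Tm h (ag i)} {A : Fm h} → Axiom (just t A ⇒ A)
  A5  : {i : Fin h} {t : Tm h (ag i)} {A : Fm h} →
        Axiom (just t A ⇒ just (! t) (just t A))
  A6  : (ts : (i : Fin h) → Tm h (ag i)) {A : Fm h} →
        Axiom (bigConj h (λ i → just (ts i) A) ⇒ just (tup ts) A)
  A7  : {i : Fin h} {t : Tm h E} {A : Fm h} → Axiom (just t A ⇒ just (proj i t) A)
  A8a : {t : Tm h C} {A : Fm h} → Axiom (just t A ⇒ just (hd t) A)
  A8b : {t : Tm h C} {A : Fm h} → Axiom (just t A ⇒ just (tl t) (just t A))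
  A9  : {t : Tm h C} {u : Tm h E} {A : Fm h} →
        Axiom ((A ∧' just t (A ⇒ just u A)) ⇒ just (ind t u) A)

-- Constant specifications: sets of formulas c:_⊛ A with c ∈ Cons_⊛ and
-- A an axiom.  inCS s c A  means  c:_s A ∈ CS  (c being the c-th
-- constant of sort s).

record ConstSpec (h : ℕ) : Set₁ where
  field
    inCS   : (s : Sort h) → ℕ → Fm h → Set
    inCS-ax : {s : Sort h} {c : ℕ} {A : Fm h} → inCS s c A → Axiom A
open ConstSpec public

infix 2 _⊢_

data _⊢_ {h : ℕ} (cs : ConstSpec h) : Fm h → Set where
  ax  : {A : Fm h} → Axiom A → cs ⊢ A
  mp  : {A B : Fm h} → cs ⊢ (A ⇒ B) → cs ⊢ A → cs ⊢ B
  nec : {s : Sort h} {c : ℕ} {A : Fm h} → inCS cs s c A → cs ⊢ just (cns {s = s} c) A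

module _ {h : ℕ} {W : Set} (R : Fin h → W → W → Set) where
  RE : W → W → Set
  RE w v = Σ (Fin h) (λ i → R i w v)

  RC : W → W → Set
  RC = TransClosure RE

  RelOf : Sort h → W → W → Set
  RelOf (ag i) = R i
  RelOf E      = RE
  RelOf C      = RC

record AFModel {h : ℕ} (cs : ConstSpec h) : Set₁ where
  field
    W     : Set
    R     : Fin h → W → W → Set
    R-refl  : (i : Fin h) (w : W) → R i w w
    R-trans : (i : Fin h) {u v w : W} → R i u v → R i v w → R i u w
    ν     : ℕ → W → Set
    Ev    : W → {s : Sort h} → Tm h s → Fm h → Set        -- A ∈ 𝓔_s(w,t)

  field
    mono   : {s : Sort h} → Star s → {w v : W} → RelOf R s w v →
             {t : Tm h s} {A : Fm h} → Ev w t A → Ev v t A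
    ev-cs  : {w : W} {s : Sort h} {c : ℕ} {A : Fm h} →
             inCS cs s c A → Ev w (cns {s = s} c) A
    ev-app : {w : W} {s : Sort h} (p : Star s) {t u : Tm h s} {A B : Fm h} →
             Ev w t (A ⇒ B) → Ev w u A → Ev w (app p t u) B
    ev-sumˡ : {w : W} {s : Sort h} (p : Star s) {t u : Tm h s} {A : Fm h} →
             Ev w u A → Ev w (plus p u t) A
    ev-sumʳ : {w : W} {s : Sort h} (p : Star s) {t u : Tm h s} {A : Fm h} →
             Ev w t A → Ev w (plus p u t) A
    ev-ins : {w : W} {i : Fin h} {t : Tm h (ag i)} {A : Fm h} →
             Ev w t A → Ev w (! t) (just t A)
    ev-tup : {w : W} (ts : (i : Fin h) → Tm h (ag i)) {A : Fm h} →
             ((i : Fin h) → Ev w (ts i) A) → Ev w (tup ts) A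
    ev-proj : {w : W} (i : Fin h) {t : Tm h E} {A : Fm h} →
             Ev w t A → Ev w (proj i t) A
    ev-hd  : {w : W} {t : Tm h C} {A : Fm h} → Ev w t A → Ev w (hd t) A
    ev-tl  : {w : W} {t : Tm h C} {A : Fm h} → Ev w t A → Ev w (tl t) (just t A)
    ev-ind : {w : W} {t : Tm h C} {u : Tm h E} {A : Fm h} →
             Ev w u A → Ev w t (A ⇒ just u A) → Ev w (ind t u) A

  _⊩_ : W → Fm h → Set
  w ⊩ atom p   = ν p w
  w ⊩ (¬' A)   = w ⊩ A → ⊥
  w ⊩ (A ∧' B) = (w ⊩ A) × (w ⊩ B)
  w ⊩ (A ∨' B) = (w ⊩ A) ⊎ (w ⊩ B)
  w ⊩ (A ⇒ B)  = w ⊩ A → w ⊩ B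
  w ⊩ just {s} t A = Ev w t A × ((v : W) → RelOf R s w v → v ⊩ A)

  Valid : Fm h → Set
  Valid A = (w : W) → w ⊩ A

open AFModel public

IsMModel : {h : ℕ} {cs : ConstSpec h} → AFModel cs → Set
IsMModel M = Σ (W M) (λ w₀ → (v : W M) → v ≡ w₀)

-- Soundness holds in every AF-model: each axiom is valid by the corresponding closure condition on the
-- evidence function together with the frame conditions (reflexivity, transitivity, induction along R_C),
-- and propositional tautologies are valid because excluded middle makes truth at a world a Boolean
-- valuation. For completeness, if A is not derivable, extend the empty set of hypotheses to a finite Γ
-- that still does not derive A but decides every subformula D of A, in the sense Γ ⊢ D or Γ ⊢ D → A.
-- The one-world model whose evidence sets and atoms are the Γ-theorems then satisfies exactly the
-- Γ-theorems among the subformulas of A, so it refutes A. Since h ≥ 1, justifications of every sort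
-- are factive (t:_E A → π₁t:₁A → A, and hd for C), which is what makes Γ ⊢ t:B imply that the one
-- world satisfies t:B.
module Submission where

open import Defs
open import Data.Nat using (ℕ; _≤_; suc; s≤s; z≤n)
open import Data.Fin using (Fin; zero; suc)
open import Data.Bool using (Bool; not; _∨_; T)
open import Data.Bool.Properties using (T-≡; T-∧; T-∨)
open import Data.Product using (Σ; _×_; _,_; proj₁; proj₂)
open import Data.Sum using (_⊎_; inj₁; inj₂; [_,_]′)
open import Data.Empty using (⊥-elim)
open import Data.Unit using (⊤; tt)
open import Data.List using (List; []; _∷_; _++_; map)
open import Data.List.Relation.Unary.All using (All; []; _∷_)
import Data.List.Relation.Unary.All as All
open import Data.List.Relation.Unary.All.Properties using (map⁺; map⁻; ++⁻)
open import Function using (_∘_; id; const)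
open import Function.Bundles using (_⇔_; mk⇔; Equivalence)
open import Axiom.ExcludedMiddle using (ExcludedMiddle)
open import Level using (0ℓ)
open import Relation.Nullary using (¬_; yes; no; does; proof)
open import Relation.Nullary.Reflects using (Reflects; ofʸ; ofⁿ; T-reflects; ¬-reflects; _×-reflects_; _⊎-reflects_; _→-reflects_)
open import Relation.Nullary.Decidable using (T?; decidable-stable)
open import Relation.Binary.PropositionalEquality using (refl)
open import Relation.Binary.Construct.Closure.Transitive using ([_]; _∷_)

open Equivalence using (to; from)

private
  variable
    h : ℕ
    cs : ConstSpec h

T⇔-reflected : {P : Set} {b : Bool} → Reflects P b → T b ⇔ P
T⇔-reflected (ofʸ p)  = mk⇔ (const p) (const tt)
T⇔-reflected (ofⁿ ¬p) = mk⇔ (λ ()) ¬p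

T-not : {a : Bool} → T (not a) ⇔ (¬ T a)
T-not {a} = T⇔-reflected (¬-reflects (T-reflects a))

T-→ : {a b : Bool} → T (not a ∨ b) ⇔ (T a → T b)
T-→ {a} {b} = T⇔-reflected (T-reflects a →-reflects T-reflects b)

T-stable : {b : Bool} → ¬ ¬ T b → T b
T-stable = decidable-stable (T? _)


module Soundness {h : ℕ} {cs : ConstSpec h} (em : ExcludedMiddle 0ℓ) (i₀ : Fin h) (M : AFModel cs) where
  module M = AFModel M

  RelOf-refl : (s : Sort h) (w : M.W) → RelOf M.R s w w
  RelOf-refl (ag i) w = M.R-refl i w
  RelOf-refl E      w = i₀ , M.R-refl i₀ w
  RelOf-refl C      w = [ i₀ , M.R-refl i₀ w ]

  ⊩-reflects-evalB : (w : M.W) (B : Fm h) →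
    Reflects (w M.⊩ B) (evalB (λ p → does (em {M.ν p w})) (λ t K → does (em {w M.⊩ just t K})) B)
  ⊩-reflects-evalB w (atom p)   = proof em
  ⊩-reflects-evalB w (¬' B)     = ¬-reflects (⊩-reflects-evalB w B)
  ⊩-reflects-evalB w (B ∧' K)   = ⊩-reflects-evalB w B ×-reflects ⊩-reflects-evalB w K
  ⊩-reflects-evalB w (B ∨' K)   = ⊩-reflects-evalB w B ⊎-reflects ⊩-reflects-evalB w K
  ⊩-reflects-evalB w (B ⇒ K)    = ⊩-reflects-evalB w B →-reflects ⊩-reflects-evalB w K
  ⊩-reflects-evalB w (just t B) = proof em

  tautology-valid : {B : Fm h} → Tautology B → Valid M B
  tautology-valid {B} τ w = to (T⇔-reflected (⊩-reflects-evalB w B)) (from T-≡ (τ _ _))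

  ⊩-bigConj⁻ : (n : ℕ) (f : Fin n → Fm h) {w : M.W} → w M.⊩ bigConj n f → (i : Fin n) → w M.⊩ f i
  ⊩-bigConj⁻ 1             f c zero    = c
  ⊩-bigConj⁻ (suc (suc n)) f c zero    = proj₁ c
  ⊩-bigConj⁻ (suc (suc n)) f c (suc i) = ⊩-bigConj⁻ (suc n) (f ∘ suc) (proj₂ c) i

  ⊩-RC-induction : {A : Fm h} {u : Tm h E} {x z : M.W} →
    x M.⊩ A → x M.⊩ (A ⇒ just u A) → (∀ {y} → RC M.R x y → y M.⊩ (A ⇒ just u A)) →
    RC M.R x z → z M.⊩ A
  ⊩-RC-induction a step steps [ r ]    = proj₂ (step a) _ r
  ⊩-RC-induction a step steps (r ∷ rs) =
    ⊩-RC-induction (proj₂ (step a) _ r) (steps [ r ]) (steps ∘ (r ∷_)) rs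

  axiom-valid : {B : Fm h} → Axiom B → Valid M B
  axiom-valid {B} (A1 τ) = tautology-valid {B} τ
  axiom-valid (A2 p)  w (e , f) (e′ , f′) = M.ev-app p e e′ , λ v r → f v r (f′ v r)
  axiom-valid (A3l p) w (e , f) = M.ev-sumˡ p e , f
  axiom-valid (A3r p) w (e , f) = M.ev-sumʳ p e , f
  axiom-valid (A4 {i}) w (e , f) = f w (M.R-refl i w)
  axiom-valid (A5 {i}) w (e , f) =
    M.ev-ins e , λ v r → M.mono (agS i) r e , λ u r′ → f u (M.R-trans i r r′)
  axiom-valid (A6 ts) w c =
    M.ev-tup ts (proj₁ ∘ conj) , λ { v (i , r) → proj₂ (conj i) v r }
    where conj = ⊩-bigConj⁻ _ _ c
  axiom-valid (A7 {i}) w (e , f) = M.ev-proj i e , λ v r → f v (i , r)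
  axiom-valid A8a w (e , f) = M.ev-hd e , λ v r → f v [ r ]
  axiom-valid A8b w (e , f) = M.ev-tl e , λ v r → M.mono CS [ r ] e , λ u r′ → f u (r ∷ r′)
  axiom-valid A9 w (a , e , f) =
    M.ev-ind (proj₁ (step a)) e , λ v → ⊩-RC-induction a step (λ {y} r → f y r)
    where step = f w (RelOf-refl C w)

  theorem-valid : {B : Fm h} → cs ⊢ B → Valid M B
  theorem-valid (ax a)  w = axiom-valid a w
  theorem-valid (mp d e) w = theorem-valid d w (theorem-valid e w)
  theorem-valid (nec c∈) w = M.ev-cs c∈ , λ v _ → axiom-valid (inCS-ax cs c∈) v


infixr 4 _⇒*_
infix 2 _∣_⊢_

_⇒*_ : List (Fm h) → Fm h → Fm h
[]      ⇒* X = X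
(B ∷ Γ) ⇒* X = B ⇒ (Γ ⇒* X)

record _∣_⊢_ (cs : ConstSpec h) (Γ : List (Fm h)) (X : Fm h) : Set where
  constructor ⟨_⟩
  field ⇒*-derivable : cs ⊢ Γ ⇒* X
open _∣_⊢_

infix 2 _⊨ᵇ_

_⊨ᵇ_ : List (Fm h) → Fm h → Set
_⊨ᵇ_ {h} Ps X = (v : ℕ → Bool) (j : {s : Sort h} → Tm h s → Fm h → Bool) →
  All (λ P → T (evalB v j P)) Ps → T (evalB v j X)

T-⇒* : {v : ℕ → Bool} {j : {s : Sort h} → Tm h s → Fm h → Bool} (Γ : List (Fm h)) {X : Fm h} →
  T (evalB v j (Γ ⇒* X)) ⇔ (All (λ P → T (evalB v j P)) Γ → T (evalB v j X))
T-⇒* []      = mk⇔ const (λ f → f [])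
T-⇒* (B ∷ Γ) = mk⇔
  (λ { f (b ∷ bs) → to (T-⇒* Γ) (to T-→ f b) bs })
  (λ g → from T-→ (λ b → from (T-⇒* Γ) (g ∘ (b ∷_))))

⊢-⇒*-elim : {Ps : List (Fm h)} {X : Fm h} → cs ⊢ Ps ⇒* X → All (cs ⊢_) Ps → cs ⊢ X
⊢-⇒*-elim d []       = d
⊢-⇒*-elim d (e ∷ es) = ⊢-⇒*-elim (mp d e) es

⊢-tautological : {Ps : List (Fm h)} {X : Fm h} → Ps ⊨ᵇ X → All (cs ⊢_) Ps → cs ⊢ X
⊢-tautological {Ps = Ps} τ =
  ⊢-⇒*-elim (ax (A1 λ v j → to T-≡ (from (T-⇒* Ps) (τ v j))))

∣-tautological : {Γ Ps : List (Fm h)} {X : Fm h} → Ps ⊨ᵇ X → All (cs ∣ Γ ⊢_) Ps → cs ∣ Γ ⊢ X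
∣-tautological {Γ = Γ} {Ps} {X} τ ds =
  ⟨ ⊢-tautological {Ps = map (Γ ⇒*_) Ps} sem (map⁺ (All.map ⇒*-derivable ds)) ⟩
  where
  sem : map (Γ ⇒*_) Ps ⊨ᵇ (Γ ⇒* X)
  sem v j hyps = from (T-⇒* Γ) λ γ → τ v j (All.map (λ hyp → to (T-⇒* Γ) hyp γ) (map⁻ hyps))

module _ {Γ : List (Fm h)} where

  ∣-theorem : {B : Fm h} → cs ⊢ B → cs ∣ Γ ⊢ B
  ∣-theorem d = ⟨ ⊢-tautological (λ { _ _ (b ∷ []) → from (T-⇒* Γ) (const b) }) (d ∷ []) ⟩

  ∣-axiom : {B : Fm h} → Axiom B → cs ∣ Γ ⊢ B
  ∣-axiom = ∣-theorem ∘ ax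

  ∣-mp : {B K : Fm h} → cs ∣ Γ ⊢ B ⇒ K → cs ∣ Γ ⊢ B → cs ∣ Γ ⊢ K
  ∣-mp d e = ∣-tautological (λ { _ _ (f ∷ b ∷ []) → to T-→ f b }) (d ∷ e ∷ [])

  ∣-∧-intro : {B K : Fm h} → cs ∣ Γ ⊢ B → cs ∣ Γ ⊢ K → cs ∣ Γ ⊢ B ∧' K
  ∣-∧-intro d e = ∣-tautological (λ { _ _ (b ∷ k ∷ []) → from T-∧ (b , k) }) (d ∷ e ∷ [])

  ∣-weaken : {K X : Fm h} → cs ∣ Γ ⊢ X → cs ∣ K ∷ Γ ⊢ X
  ∣-weaken ⟨ d ⟩ = ⟨ ⊢-tautological (λ { _ _ (x ∷ []) → from T-→ (const x) }) (d ∷ []) ⟩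

  ∣-assumption : {K : Fm h} → cs ∣ K ∷ Γ ⊢ K
  ∣-assumption = ⟨ ⊢-tautological (λ { _ _ [] → from T-→ λ k → from (T-⇒* Γ) (const k) }) [] ⟩

  ∣-deduction : {K X : Fm h} → cs ∣ K ∷ Γ ⊢ X → cs ∣ Γ ⊢ K ⇒ X
  ∣-deduction ⟨ d ⟩ = ⟨ ⊢-tautological
    (λ { _ _ (f ∷ []) → from (T-⇒* Γ) λ γ → from T-→ λ k → to (T-⇒* Γ) (to T-→ f k) γ })
    (d ∷ []) ⟩

  ∣-factive : Fin h → {s : Sort h} {t : Tm h s} {B : Fm h} → cs ∣ Γ ⊢ just t B → cs ∣ Γ ⊢ B
  ∣-factive i₀ {ag i} e = ∣-mp (∣-axiom A4) e
  ∣-factive i₀ {E}    e = ∣-mp (∣-axiom A4) (∣-mp (∣-axiom (A7 {i = i₀})) e)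
  ∣-factive i₀ {C}    e = ∣-factive i₀ {E} (∣-mp (∣-axiom A8a) e)

  ∣-bigConj : (n : ℕ) (f : Fin n → Fm h) → ((i : Fin n) → cs ∣ Γ ⊢ f i) → cs ∣ Γ ⊢ bigConj n f
  ∣-bigConj 0             f d = ∣-tautological (λ { v _ [] → from (T-→ {v 0}) id }) []
  ∣-bigConj 1             f d = d zero
  ∣-bigConj (suc (suc n)) f d = ∣-∧-intro (d zero) (∣-bigConj (suc n) (f ∘ suc) (d ∘ suc))


Decided : ConstSpec h → Fm h → List (Fm h) → Fm h → Set
Decided cs A Γ D = (cs ∣ Γ ⊢ D) ⊎ (cs ∣ Γ ⊢ D ⇒ A)

lindenbaum : ExcludedMiddle 0ℓ → {A : Fm h} (L Γ₀ : List (Fm h)) → ¬ (cs ∣ Γ₀ ⊢ A) →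
  Σ (List (Fm h)) λ Γ →
    ¬ (cs ∣ Γ ⊢ A) × (∀ {X} → cs ∣ Γ₀ ⊢ X → cs ∣ Γ ⊢ X) × All (Decided cs A Γ) L
lindenbaum em []      Γ₀ Γ₀⊬A = Γ₀ , Γ₀⊬A , id , []
lindenbaum {cs = cs} em {A} (K ∷ L) Γ₀ Γ₀⊬A with em {cs ∣ K ∷ Γ₀ ⊢ A}
... | yes K,Γ₀⊢A =
  let Γ , Γ⊬A , extends , decided = lindenbaum em L Γ₀ Γ₀⊬A
  in  Γ , Γ⊬A , extends , inj₂ (extends (∣-deduction K,Γ₀⊢A)) ∷ decided
... | no K,Γ₀⊬A =
  let Γ , Γ⊬A , extends , decided = lindenbaum em L (K ∷ Γ₀) K,Γ₀⊬A
  in  Γ , Γ⊬A , extends ∘ ∣-weaken , inj₁ (extends ∣-assumption) ∷ decided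

subformulas properSubformulas : Fm h → List (Fm h)
subformulas D = D ∷ properSubformulas D
properSubformulas (atom p)   = []
properSubformulas (¬' B)     = subformulas B
properSubformulas (B ∧' K)   = subformulas B ++ subformulas K
properSubformulas (B ∨' K)   = subformulas B ++ subformulas K
properSubformulas (B ⇒ K)    = subformulas B ++ subformulas K
properSubformulas (just t B) = subformulas B


module Canonical {h : ℕ} (cs : ConstSpec h) (i₀ : Fin h) (Γ : List (Fm h)) where

  canonical : AFModel cs
  canonical = record
    { W       = ⊤
    ; R       = λ _ _ _ → ⊤
    ; R-refl  = λ _ _ → tt
    ; R-trans = λ _ _ _ → tt
    ; ν       = λ p _ → cs ∣ Γ ⊢ atom p
    ; Ev      = λ _ t B → cs ∣ Γ ⊢ just t B
    ; mono    = λ _ _ → id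
    ; ev-cs   = ∣-theorem ∘ nec
    ; ev-app  = λ p d e → ∣-mp (∣-mp (∣-axiom (A2 p)) d) e
    ; ev-sumˡ = λ p → ∣-mp (∣-axiom (A3l p))
    ; ev-sumʳ = λ p → ∣-mp (∣-axiom (A3r p))
    ; ev-ins  = ∣-mp (∣-axiom A5)
    ; ev-tup  = λ ts d → ∣-mp (∣-axiom (A6 ts)) (∣-bigConj _ _ d)
    ; ev-proj = λ i → ∣-mp (∣-axiom A7)
    ; ev-hd   = ∣-mp (∣-axiom A8a)
    ; ev-tl   = ∣-mp (∣-axiom A8b)
    ; ev-ind  = λ d e → ∣-mp (∣-axiom A9) (∣-∧-intro (∣-factive i₀ d) e)
    }

  canonical-isMModel : IsMModel canonical
  canonical-isMModel = tt , λ _ → refl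

  ⊩_ : Fm h → Set
  ⊩ D = _⊩_ canonical tt D

  module _ {A : Fm h} (Γ⊬A : ¬ (cs ∣ Γ ⊢ A)) where

    absurd : {Ps : List (Fm h)} {X : Set} → Ps ⊨ᵇ A → All (cs ∣ Γ ⊢_) Ps → X
    absurd τ ds = ⊥-elim (Γ⊬A (∣-tautological τ ds))

    truth : (D : Fm h) → All (Decided cs A Γ) (subformulas D) → (⊩ D) ⇔ (cs ∣ Γ ⊢ D)
    truth (atom p) _ = mk⇔ id id
    truth (¬' B) (decided¬B ∷ ds) = mk⇔ (forth decided¬B (All.head ds)) (λ d b → absurd
        (λ { _ _ (x ∷ y ∷ []) → ⊥-elim (to T-not x y) }) (d ∷ to ih b ∷ []))
      where
      ih = truth B ds
      forth : Decided cs A Γ (¬' B) → Decided cs A Γ B → ¬ (⊩ B) → cs ∣ Γ ⊢ ¬' B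
      forth (inj₁ ⊢¬B)  _          ⊮B = ⊢¬B
      forth (inj₂ _)    (inj₁ ⊢B)  ⊮B = ⊥-elim (⊮B (from ih ⊢B))
      forth (inj₂ ¬B⇒A) (inj₂ B⇒A) ⊮B = absurd
        (λ { _ _ (f ∷ g ∷ []) → T-stable λ ¬a → ¬a (to T-→ f (from T-not (¬a ∘ to T-→ g))) })
        (¬B⇒A ∷ B⇒A ∷ [])
    truth (B ∧' K) (_ ∷ ds) with ++⁻ (subformulas B) ds
    ... | dsB , dsK = mk⇔
      (λ (b , k) → ∣-∧-intro (to ihB b) (to ihK k))
      (λ d → from ihB (∣-tautological (λ { _ _ (c ∷ []) → proj₁ (to T-∧ c) }) (d ∷ [])) ,
             from ihK (∣-tautological (λ { _ _ (c ∷ []) → proj₂ (to T-∧ c) }) (d ∷ [])))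
      where
      ihB = truth B dsB
      ihK = truth K dsK
    truth (B ∨' K) (_ ∷ ds) with ++⁻ (subformulas B) ds
    ... | dsB , dsK = mk⇔ forth (back (All.head dsB) (All.head dsK))
      where
      ihB = truth B dsB
      ihK = truth K dsK
      forth : (⊩ B) ⊎ (⊩ K) → cs ∣ Γ ⊢ B ∨' K
      forth (inj₁ b) = ∣-tautological (λ { _ _ (x ∷ []) → from T-∨ (inj₁ x) }) (to ihB b ∷ [])
      forth (inj₂ k) = ∣-tautological (λ { _ _ (x ∷ []) → from T-∨ (inj₂ x) }) (to ihK k ∷ [])
      back : Decided cs A Γ B → Decided cs A Γ K → cs ∣ Γ ⊢ B ∨' K → (⊩ B) ⊎ (⊩ K)
      back (inj₁ ⊢B)  _          d = inj₁ (from ihB ⊢B)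
      back (inj₂ _)   (inj₁ ⊢K)  d = inj₂ (from ihK ⊢K)
      back (inj₂ B⇒A) (inj₂ K⇒A) d = absurd
        (λ { _ _ (x ∷ f ∷ g ∷ []) → [ to T-→ f , to T-→ g ]′ (to T-∨ x) })
        (d ∷ B⇒A ∷ K⇒A ∷ [])
    truth (B ⇒ K) (decidedB⇒K ∷ ds) with ++⁻ (subformulas B) ds
    ... | dsB , dsK = mk⇔ (forth (All.head dsB) decidedB⇒K) (λ d b → from ihK (∣-mp d (to ihB b)))
      where
      ihB = truth B dsB
      ihK = truth K dsK
      forth : Decided cs A Γ B → Decided cs A Γ (B ⇒ K) → (⊩ B → ⊩ K) → cs ∣ Γ ⊢ B ⇒ K
      forth (inj₁ ⊢B)  _            f = ∣-tautological
        (λ { _ _ (k ∷ []) → from T-→ (const k) }) (to ihK (f (from ihB ⊢B)) ∷ [])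
      forth (inj₂ _)   (inj₁ ⊢B⇒K)  f = ⊢B⇒K
      forth (inj₂ B⇒A) (inj₂ B⇒K⇒A) f = absurd
        (λ { _ _ (x ∷ y ∷ []) → T-stable λ ¬a → ¬a (to T-→ x (from T-→ (⊥-elim ∘ ¬a ∘ to T-→ y))) })
        (B⇒K⇒A ∷ B⇒A ∷ [])
    truth (just t B) (_ ∷ ds) =
      mk⇔ proj₁ (λ e → e , λ _ _ → from (truth B ds) (∣-factive i₀ e))


completeness : ExcludedMiddle 0ℓ → Fin h → {A : Fm h} →
  ((M : AFModel cs) → IsMModel M → Valid M A) → cs ⊢ A
completeness {cs = cs} em i₀ {A} valid = decidable-stable em λ ⊬A →
  let Γ , Γ⊬A , _ , decided = lindenbaum em (subformulas A) [] (⊬A ∘ ⇒*-derivable)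
      open Canonical cs i₀ Γ
  in  Γ⊬A (to (truth Γ⊬A A decided) (valid canonical canonical-isMModel tt))

theorem2 : ExcludedMiddle 0ℓ →
    (h : ℕ) → 1 ≤ h → (cs : ConstSpec h) (A : Fm h) →
    (cs ⊢ A) ⇔ ((M : AFModel cs) → IsMModel M → Valid M A)
theorem2 em (suc _) (s≤s z≤n) cs A =
  mk⇔ (λ ⊢A M _ → Soundness.theorem-valid em zero M ⊢A) (completeness em zero)
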